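{- Let $G$ be a directed graph with vertex set $\mathbb{N}$, and let $\chi(G)$ denote the chromatic number of the undirected graph underlying $G$ (in which $\{a,b\}$ is an edge iff $(a,b)\in E(G)$ or $(b,a)\in E(G)$). Then $$R(G)\leq \log\chi(G).$$
   Context: For a directed graph $G$ with vertex set $\mathbb{N}$ and $n\in\mathbb{N}$, two permutations $\pi,\rho$ of $[n]=\{1,\dots,n\}$ are called $G$-different if there is $i\in[n]$ with $(\pi(i),\rho(i))\in E(G)$. A set of permutations is pairwise $G$-different if every ordered pair of distinct members $(\pi,\rho)$ of it is $G$-different. $N(G,n)$ denotes the largest cardinality of a set of pairwise $G$-different permutations of $[n]$, and the permutation capacity is $R(G)=\lim_{n\to\infty}\frac1n\log N(G,n)$ (this limit exists, possibly infinite). Logarithms are to base 2. -}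

module Defs where

open import Data.Nat using (ℕ; suc; _≤_; _<_; _*_; _^_)
open import Data.Fin using (Fin; toℕ)
open import Data.Fin.Permutation using (Permutation′; _⟨$⟩ʳ_)
open import Data.Product using (Σ; ∃; _×_)
open import Data.Sum using (_⊎_)
open import Relation.Binary.PropositionalEquality using (_≡_; _≢_)
open import Relation.Nullary using (¬_)

DiGraph : Set₁
DiGraph = ℕ → ℕ → Set

-- A permutation of [n] = {1,…,n} is represented as a permutation of Fin n;
-- the element i : Fin n stands for the natural number 1 + toℕ i.
vtx : {n : ℕ} → Fin n → ℕ
vtx i = suc (toℕ i)

GDifferent : (G : DiGraph) {n : ℕ} → Permutation′ n → Permutation′ n → Set
GDifferent G π ρ = ∃ λ i → G (vtx (π ⟨$⟩ʳ i)) (vtx (ρ ⟨$⟩ʳ i))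

SamePerm : {n : ℕ} → Permutation′ n → Permutation′ n → Set
SamePerm π ρ = ∀ i → π ⟨$⟩ʳ i ≡ ρ ⟨$⟩ʳ i

PairwiseGDifferent : (G : DiGraph) (n m : ℕ) → (Fin m → Permutation′ n) → Set
PairwiseGDifferent G n m S =
  (∀ a b → a ≢ b → ¬ SamePerm (S a) (S b)) ×
  (∀ a b → a ≢ b → GDifferent G (S a) (S b))

ProperColouring : DiGraph → (k : ℕ) → (ℕ → Fin k) → Set
ProperColouring G k c = ∀ a b → (G a b ⊎ G b a) → c a ≢ c b

ChromaticNumber : DiGraph → ℕ → Set
ChromaticNumber G k =
  (Σ (ℕ → Fin k) λ c → ProperColouring G k c) ×
  (∀ j → j < k → ¬ (Σ (ℕ → Fin j) λ c → ProperColouring G j c))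

-- R(G) ≤ log₂ k, i.e. lim_n (1/n) log₂ N(G,n) ≤ log₂ k, written without reals:
-- for every rational ε = p/q > 0, for all sufficiently large n,
-- N(G,n) ≤ k^n · 2^(ε n), i.e. N(G,n)^q ≤ k^(q n) · 2^(p n).
-- N(G,n) ≤ X is expressed as: every pairwise G-different set has size ≤ X.
CapacityAtMostLog : DiGraph → ℕ → Set
CapacityAtMostLog G k =
  ∀ (p q : ℕ) → 1 ≤ p → 1 ≤ q →
  ∃ λ n₀ → ∀ n → n₀ ≤ n →
    ∀ m (S : Fin m → Permutation′ n) → PairwiseGDifferent G n m S →
      m ^ q ≤ k ^ (q * n) * 2 ^ (p * n)

module Submission where

-- Fix a proper k-colouring c of the undirected graph underlying G.
-- Send a permutation π of [n] to its colour pattern i ↦ c(π(i)), a function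
-- Fin n → Fin k.  If π and ρ are G-different, then (π(i), ρ(i)) is an edge for
-- some i, so properness makes the two patterns differ at position i.  Hence the
-- members of a pairwise G-different set have pairwise distinct colour patterns,
-- and as there are only k^n patterns (coded injectively into Fin (k ^ n) by the
-- library's funToFin), N(G,n) ≤ k^n for every n.  This exact bound is stronger
-- than the asymptotic statement R(G) ≤ log k: raising it to the q-th power gives
-- N^q ≤ k^(qn) ≤ k^(qn)·2^(pn) for all n, so the threshold n₀ = 0 works.

open import Defs
open import Data.Nat using (ℕ; _≤_; _*_; _^_)
open import Data.Nat.Properties using (≤-trans; ^-monoˡ-≤; ^-*-assoc; *-comm; m≤m*n; m^n≢0)
open import Data.Fin using (Fin; funToFin; finToFun)
open import Data.Fin.Properties using (finToFun-funToFin; injective⇒≤; _≟_)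
open import Data.Fin.Permutation using (Permutation′; _⟨$⟩ʳ_)
open import Data.Product using (∃; _,_)
open import Data.Sum using (inj₁)
open import Data.Empty using (⊥-elim)
open import Relation.Binary.PropositionalEquality using (_≡_; _≢_; sym; trans; cong; subst; module ≡-Reasoning)
open import Relation.Nullary using (yes; no)

DifferSomewhere : {n k : ℕ} → (Fin n → Fin k) → (Fin n → Fin k) → Set
DifferSomewhere f g = ∃ λ i → f i ≢ g i

-- Pigeonhole for patterns: a family of m objects whose patterns Fin n → Fin k
-- pairwise differ somewhere has at most k^n members, because funToFin codes
-- patterns injectively into Fin (k ^ n).
distinctPatterns⇒≤ : {A : Set} {n k m : ℕ} (pat : A → Fin n → Fin k)
  (S : Fin m → A) →
  (∀ a b → a ≢ b → DifferSomewhere (pat (S a)) (pat (S b))) →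
  m ≤ k ^ n
distinctPatterns⇒≤ {n = n} {k} {m} pat S differ = injective⇒≤ {f = code} code-injective
  where
  code : Fin m → Fin (k ^ n)
  code a = funToFin (pat (S a))

  samePattern : ∀ a b → code a ≡ code b → ∀ i → pat (S a) i ≡ pat (S b) i
  samePattern a b eq i = begin
    pat (S a) i          ≡⟨ sym (finToFun-funToFin (pat (S a)) i) ⟩
    finToFun (code a) i  ≡⟨ cong (λ x → finToFun x i) eq ⟩
    finToFun (code b) i  ≡⟨ finToFun-funToFin (pat (S b)) i ⟩
    pat (S b) i          ∎
    where open ≡-Reasoning

  code-injective : ∀ {a b} → code a ≡ code b → a ≡ b
  code-injective {a} {b} eq with a ≟ b
  ... | yes a≡b = a≡b
  ... | no a≢b with differ a b a≢b
  ...   | i , differs = ⊥-elim (differs (samePattern a b eq i))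

colourPattern : {k n : ℕ} → (ℕ → Fin k) → Permutation′ n → Fin n → Fin k
colourPattern c π i = c (vtx (π ⟨$⟩ʳ i))

gDifferent⇒patternsDiffer : (G : DiGraph) {k n : ℕ} (c : ℕ → Fin k) →
  ProperColouring G k c → (π ρ : Permutation′ n) → GDifferent G π ρ →
  DifferSomewhere (colourPattern c π) (colourPattern c ρ)
gDifferent⇒patternsDiffer G c proper π ρ (i , edge) = i , proper _ _ (inj₁ edge)

pairwiseGDifferent≤ : (G : DiGraph) {k : ℕ} (c : ℕ → Fin k) → ProperColouring G k c →
  ∀ n m (S : Fin m → Permutation′ n) → PairwiseGDifferent G n m S → m ≤ k ^ n
pairwiseGDifferent≤ G c proper n m S (_ , gDifferent) =
  distinctPatterns⇒≤ (colourPattern c) S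
    (λ a b a≢b → gDifferent⇒patternsDiffer G c proper (S a) (S b) (gDifferent a b a≢b))

powerBound : ∀ {m k} n p q → m ≤ k ^ n → m ^ q ≤ k ^ (q * n) * 2 ^ (p * n)
powerBound {m} {k} n p q m≤kⁿ =
  ≤-trans (subst (m ^ q ≤_) kⁿ^q≡k^qn (^-monoˡ-≤ q m≤kⁿ))
          (m≤m*n (k ^ (q * n)) (2 ^ (p * n)) {{m^n≢0 2 (p * n)}})
  where
  kⁿ^q≡k^qn : (k ^ n) ^ q ≡ k ^ (q * n)
  kⁿ^q≡k^qn = trans (^-*-assoc k n q) (cong (k ^_) (*-comm n q))

lemma1 : (G : DiGraph) (k : ℕ) → ChromaticNumber G k → CapacityAtMostLog G k
lemma1 G k ((c , proper) , _) p q _ _ = 0 , λ n _ m S pairwise →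
  powerBound n p q (pairwiseGDifferent≤ G c proper n m S pairwise)
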